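{- Let $n\ge3$ and let $D_{n+1}$ be the forked path on vertices $\{1,\ldots,n+1\}$ with edges $e_1=\{1,3\}$, $e_2=\{2,3\}$, $e_i=\{i,i+1\}$ for $3\le i\le n$; identify the edge $e_i$ with $i$. Then the set $\{p_\sigma:\sigma\in O(D_{n+1})\}$ is precisely the set of partial orders on $\{1,\ldots,n\}$ obtained as the transitive closure of (i) a linear order on $\{1,2,3\}$ together with (ii) a choice, for each $3\le i\le n-1$, of either $i<i+1$ or $i+1<i$. (In Hasse-diagram terms: a path-type partial order on $3,\ldots,n$ with the two vertices $1,2$ attached at $3$ so that $\{1,2,3\}$ forms a chain.)
   Context: $O(D_{n+1})$ is the set of orderings of the edges (each edge exactly once), each identified with a linear order on the edge set. For an ordering $\sigma$ and vertex $v$, $\sigma|_v$ is the restriction of $\sigma$ to the edges incident with $v$, and $p_\sigma$ is the transitive closure of $\bigcup_v\sigma|_v$. -}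

module Defs where

open import Level using (0ℓ)
open import Data.Nat using (ℕ; zero; suc; _≤_; _<_)
open import Data.Fin using (Fin; toℕ; inject≤) renaming (_<_ to _<ᶠ_)
open import Data.Fin.Permutation using (Permutation′; _⟨$⟩ʳ_)
open import Data.Bool using (Bool; true; false)
open import Data.Product using (Σ; _×_)
open import Data.Sum using (_⊎_)
open import Relation.Binary.Core using (Rel)
open import Relation.Binary.PropositionalEquality using (_≡_)
open import Relation.Binary.Construct.Closure.Transitive using (TransClosure)
open import Function.Bundles using (_⇔_)

-- Conventions (0-based):
--   edge e_{k+1} of D_{n+1} is  k : Fin n ;  vertex v+1 is  v : Fin (suc n).
--   e_1 = {1,3}, e_2 = {2,3}, e_i = {i,i+1} (3 ≤ i ≤ n), i.e. 0-based
--   edge 0 = {0,2}, edge 1 = {1,2}, edge k = {k,k+1} for k ≥ 2.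

Incident : ℕ → ℕ → Set
Incident zero v = (v ≡ 0) ⊎ (v ≡ 2)
Incident (suc zero) v = (v ≡ 1) ⊎ (v ≡ 2)
Incident (suc (suc j)) v = (v ≡ suc (suc j)) ⊎ (v ≡ suc (suc (suc j)))

-- An ordering of the edges (each edge exactly once), given by the
-- bijection  pos : edges → positions.  Edge e comes before f iff pos e < pos f.
Ordering : ℕ → Set
Ordering n = Permutation′ n

_≺[_]_ : ∀ {n} → Fin n → Ordering n → Fin n → Set
e ≺[ σ ] f = (σ ⟨$⟩ʳ e) <ᶠ (σ ⟨$⟩ʳ f)

restrict : ∀ {n} → Ordering n → Fin (suc n) → Rel (Fin n) 0ℓ
restrict σ v e f = (e ≺[ σ ] f) × Incident (toℕ e) (toℕ v) × Incident (toℕ f) (toℕ v)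

unionRestrict : ∀ {n} → Ordering n → Rel (Fin n) 0ℓ
unionRestrict {n} σ e f = Σ (Fin (suc n)) λ v → restrict σ v e f

p : ∀ {n} → Ordering n → Rel (Fin n) 0ℓ
p σ = TransClosure (unionRestrict σ)

-- (i) the linear order on {1,2,3} (0-based {0,1,2}) given by a bijection
--     τ : {1,2,3} → positions, embedded into Fin n (needs 3 ≤ n)
linear123 : ∀ {n} → 3 ≤ n → Permutation′ 3 → Rel (Fin n) 0ℓ
linear123 h τ a b =
  Σ (Fin 3) λ a' → Σ (Fin 3) λ b' →
    (a ≡ inject≤ a' h) × (b ≡ inject≤ b' h) × ((τ ⟨$⟩ʳ a') <ᶠ (τ ⟨$⟩ʳ b'))

-- (ii) for each 3 ≤ i ≤ n-1 (0-based 2 ≤ k, k+1 ≤ n-1) the choice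
--      c k = true means i < i+1, c k = false means i+1 < i.
--      (values of c at other indices are irrelevant.)
pathChoice : ∀ {n} → (Fin n → Bool) → Rel (Fin n) 0ℓ
pathChoice c a b =
  ((2 ≤ toℕ a) × (toℕ b ≡ suc (toℕ a)) × (c a ≡ true))
  ⊎ ((2 ≤ toℕ b) × (toℕ a ≡ suc (toℕ b)) × (c b ≡ false))

q : ∀ {n} → 3 ≤ n → Permutation′ 3 → (Fin n → Bool) → Rel (Fin n) 0ℓ
q h τ c = TransClosure (λ a b → linear123 h τ a b ⊎ pathChoice c a b)

_≐_ : ∀ {n} → Rel (Fin n) 0ℓ → Rel (Fin n) 0ℓ → Set
R ≐ S = ∀ a b → R a b ⇔ S a b

{-# OPTIONS --safe #-}
-- Both relations are transitive closures, so it suffices that their generating relations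
-- coincide. Two edges share a vertex exactly when both lie in the fork e₁, e₂, e₃ or they
-- are consecutive path edges eᵢ, eᵢ₊₁ with i ≥ 3. Hence the generators of p_σ are the
-- σ-order on the fork together with the σ-comparisons of consecutive path edges: a generator
-- of q for τ the relative σ-order of the fork and c recording those comparisons.
-- Conversely, given τ and c, order the edges by an integer height: τ on the fork, and on
-- the later path edges heights of strictly increasing absolute value, positive iff c puts
-- the edge above its predecessor. As the predecessor's height is smaller in absolute value,
-- the sign alone decides each consecutive comparison. In both directions an injective key
-- becomes an ordering by ranking: the rank of a is the number of elements of smaller key.
module Submission where

open import Defs
open import Level using (0ℓ)
open import Data.Bool using (Bool; true; false)
open import Data.Bool.Properties using (¬-not)
open import Data.Fin using (Fin; zero; suc; toℕ; fromℕ<; inject₁; inject≤; punchOut) renaming (_<_ to _<ᶠ_)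
open import Data.Fin.Properties
  using ( toℕ-fromℕ<; toℕ-injective; inject≤-injective; toℕ-inject≤; toℕ-inject₁; toℕ<n; toℕ≤pred[n]
        ; injective⇒≤; punchOut-injective; any?; _≟_; <-isStrictTotalOrder; ≤∧≢⇒<)
  renaming (_<?_ to _<ᶠ?_)
open import Data.Fin.Permutation using (Permutation′; permutation; _⟨$⟩ʳ_)
open import Data.Fin.Subset using (Subset; _∈_; _∉_; _⊂_; ⊤; ∣_∣)
open import Data.Fin.Subset.Properties using (∈⊤; ⊆⊤; p⊂q⇒∣p∣<∣q∣; ∣⊤∣≡n)
open import Data.Integer using (ℤ; +_; -_; -[1+_]; -<-; -<+; +<+) renaming (_<_ to _<ℤ_; ∣_∣ to ∣_∣ℤ)
open import Data.Integer.Properties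
  using (+-injective; ∣-i∣≡∣i∣; drop‿+<+)
  renaming (<-isStrictTotalOrder to <ℤ-isStrictTotalOrder; <-asym to <ℤ-asym)
open import Data.Nat as ℕ using (ℕ; zero; suc; _+_; _≤_; _<_; _⊔_; z≤n; s≤s)
import Data.Nat.Properties as ℕ
open import Data.Product using (Σ; ∃; _×_; _,_; proj₁; proj₂; map)
open import Data.Sum using (_⊎_; inj₁; inj₂)
open import Data.Vec using (tabulate)
open import Data.Vec.Properties using (lookup∘tabulate; []=⇒lookup; lookup⇒[]=)
open import Function using (_∘_)
open import Function.Bundles using (_⇔_; mk⇔; Equivalence; Injection)
open import Function.Definitions using (Injective)
import Function.Properties.Equivalence as ⇔
open import Function.Properties.Inverse using (↔⇒↣)
open import Relation.Binary.Core using (Rel; _⇒_)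
open import Relation.Binary.Definitions using (tri<; tri≈; tri>)
open import Relation.Binary.Structures using (IsStrictTotalOrder)
open import Relation.Binary.PropositionalEquality
open import Relation.Binary.Construct.Closure.Transitive using (TransClosure; [_]; _∷_)
open import Relation.Nullary using (Dec; yes; no; does; ¬_; contradiction)
open import Relation.Nullary.Decidable using (dec-true)

TransClosure-map : ∀ {A : Set} {R S : Rel A 0ℓ} → R ⇒ S → TransClosure R ⇒ TransClosure S
TransClosure-map R⇒S [ r ] = [ R⇒S r ]
TransClosure-map R⇒S (r ∷ rs) = R⇒S r ∷ TransClosure-map R⇒S rs

TransClosure-cong : ∀ {A : Set} {R S : Rel A 0ℓ} → (∀ a b → R a b ⇔ S a b) →
                    ∀ a b → TransClosure R a b ⇔ TransClosure S a b
TransClosure-cong R⇔S _ _ =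
  mk⇔ (TransClosure-map (Equivalence.to (R⇔S _ _))) (TransClosure-map (Equivalence.from (R⇔S _ _)))

does≡true⇔ : ∀ {P : Set} (P? : Dec P) → P ⇔ (does P? ≡ true)
does≡true⇔ (yes p) = mk⇔ (λ _ → refl) (λ _ → p)
does≡true⇔ (no ¬p) = mk⇔ (λ p → contradiction p ¬p) (λ ())

⟨$⟩ʳ-injective : ∀ {n} (π : Permutation′ n) → Injective _≡_ _≡_ (π ⟨$⟩ʳ_)
⟨$⟩ʳ-injective π = Injection.injective (↔⇒↣ π)

toℕ-inject≤< : ∀ {m n} (x : Fin m) .(h : m ≤ n) → toℕ (inject≤ x h) < m
toℕ-inject≤< x h = subst (_< _) (sym (toℕ-inject≤ x h)) (toℕ<n x)

inject≤-fromℕ< : ∀ {m n} .(h : m ≤ n) (a : Fin n) (a<m : toℕ a < m) → a ≡ inject≤ (fromℕ< a<m) h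
inject≤-fromℕ< h a a<m = toℕ-injective (sym (trans (toℕ-inject≤ _ h) (toℕ-fromℕ< a<m)))

signed : Bool → ℕ → ℤ
signed true k = + k
signed false k = - + k

∣signed∣ : ∀ s k → ∣ signed s k ∣ℤ ≡ k
∣signed∣ true k = refl
∣signed∣ false k = ∣-i∣≡∣i∣ (+ k)

∣x∣<k⇒-k<x<k : ∀ {x k} → ∣ x ∣ℤ < k → (- + k <ℤ x) × (x <ℤ + k)
∣x∣<k⇒-k<x<k {+ _} {suc _} m<k = -<+ , +<+ m<k
∣x∣<k⇒-k<x<k { -[1+ _ ]} {suc _} (s≤s m<k) = -<- m<k , -<+

<-signed⇔ : ∀ {x k} s → ∣ x ∣ℤ < k → (x <ℤ signed s k) ⇔ (s ≡ true)
<-signed⇔ true ∣x∣<k = mk⇔ (λ _ → refl) (λ _ → proj₂ (∣x∣<k⇒-k<x<k ∣x∣<k))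
<-signed⇔ false ∣x∣<k =
  mk⇔ (λ x<-k → contradiction x<-k (<ℤ-asym (proj₁ (∣x∣<k⇒-k<x<k ∣x∣<k)))) (λ ())

injective⇒surjective : ∀ {n} {f : Fin n → Fin n} → Injective _≡_ _≡_ f →
                       ∀ i → ∃ λ j → f j ≡ i
injective⇒surjective {suc n} {f} f-inj i with any? (λ j → f j ≟ i)
... | yes hit = hit
... | no miss = contradiction (injective⇒≤ avoid-i-injective) ℕ.1+n≰n
  where
  avoid-i : Fin (suc n) → Fin n
  avoid-i j = punchOut {i = i} {j = f j} (λ i≡fj → miss (j , sym i≡fj))

  avoid-i-injective : Injective _≡_ _≡_ avoid-i
  avoid-i-injective = f-inj ∘ punchOut-injective {i = i} _ _

injective⇒permutation : ∀ {n} {f : Fin n → Fin n} → Injective _≡_ _≡_ f → Permutation′ n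
injective⇒permutation {f = f} f-inj =
  permutation f (proj₁ ∘ surj) (proj₂ ∘ surj) (λ j → f-inj (proj₂ (surj (f j))))
  where
  surj : ∀ i → ∃ λ j → f j ≡ i
  surj = injective⇒surjective f-inj

module Ranking {A : Set} {_≺_ : Rel A 0ℓ} (≺-sto : IsStrictTotalOrder _≡_ _≺_)
               {k} (f : Fin k → A) (f-inj : Injective _≡_ _≡_ f) where

  open IsStrictTotalOrder ≺-sto using (compare; irrefl; _<?_) renaming (trans to ≺-trans)

  below : Fin k → Subset k
  below a = tabulate λ b → does (f b <? f a)

  ∈-below : ∀ {a b} → b ∈ below a → f b ≺ f a
  ∈-below {a} {b} b∈ with f b <? f a | trans (sym (lookup∘tabulate _ b)) ([]=⇒lookup b∈)
  ... | yes fb≺fa | _ = fb≺fa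
  ... | no _ | ()

  below-∈ : ∀ {a b} → f b ≺ f a → b ∈ below a
  below-∈ {a} {b} fb≺fa = lookup⇒[]= b _ (trans (lookup∘tabulate _ b) (dec-true (f b <? f a) fb≺fa))

  ∉-below-self : ∀ a → a ∉ below a
  ∉-below-self a a∈ = irrefl refl (∈-below a∈)

  below-⊂ : ∀ {a b} → f a ≺ f b → below a ⊂ below b
  below-⊂ {a} fa≺fb = (λ c∈ → below-∈ (≺-trans (∈-below c∈) fa≺fb)) , a , below-∈ fa≺fb , ∉-below-self a

  rank : Fin k → Fin k
  rank a = fromℕ< (subst (∣ below a ∣ <_) (∣⊤∣≡n k) (p⊂q⇒∣p∣<∣q∣ (⊆⊤ , a , ∈⊤ , ∉-below-self a)))

  rank-mono : ∀ {a b} → f a ≺ f b → rank a <ᶠ rank b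
  rank-mono fa≺fb = subst₂ _<_ (sym (toℕ-fromℕ< _)) (sym (toℕ-fromℕ< _)) (p⊂q⇒∣p∣<∣q∣ (below-⊂ fa≺fb))

  rank-injective : Injective _≡_ _≡_ rank
  rank-injective {a} {b} eq with compare (f a) (f b)
  ... | tri< fa≺fb _ _ = contradiction (cong toℕ eq) (ℕ.<⇒≢ (rank-mono fa≺fb))
  ... | tri≈ _ fa≡fb _ = f-inj fa≡fb
  ... | tri> _ _ fb≺fa = contradiction (cong toℕ (sym eq)) (ℕ.<⇒≢ (rank-mono fb≺fa))

  rank-reflects : ∀ {a b} → rank a <ᶠ rank b → f a ≺ f b
  rank-reflects {a} {b} r with compare (f a) (f b)
  ... | tri< fa≺fb _ _ = fa≺fb
  ... | tri≈ _ fa≡fb _ = contradiction (subst (λ c → rank a <ᶠ rank c) (sym (f-inj fa≡fb)) r) (ℕ.<-irrefl refl)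
  ... | tri> _ _ fb≺fa = contradiction r (ℕ.<-asym (rank-mono fb≺fa))

  ranking : Permutation′ k
  ranking = injective⇒permutation rank-injective

  ranking-<⇔ : ∀ a b → (ranking ⟨$⟩ʳ a <ᶠ ranking ⟨$⟩ʳ b) ⇔ (f a ≺ f b)
  ranking-<⇔ a b = mk⇔ rank-reflects rank-mono

data Meet : ℕ → ℕ → Set where
  fork : ∀ {a b} → a < 3 → b < 3 → Meet a b
  next : ∀ {a b} → 2 ≤ a → b ≡ suc a → Meet a b
  prev : ∀ {a b} → 2 ≤ b → a ≡ suc b → Meet a b

incident-2 : ∀ {a} → a < 3 → Incident a 2
incident-2 {0} _ = inj₂ refl
incident-2 {1} _ = inj₂ refl
incident-2 {2} _ = inj₁ refl
incident-2 {suc (suc (suc _))} (s≤s (s≤s (s≤s ())))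

fork-meets-path : ∀ {a v} j → (v ≡ a ⊎ v ≡ 2) → Incident (2 + j) v → a < 2 → 2 + j < 3
fork-meets-path _ (inj₁ refl) (inj₁ refl) (s≤s (s≤s ()))
fork-meets-path _ (inj₁ refl) (inj₂ refl) (s≤s (s≤s ()))
fork-meets-path _ (inj₂ refl) (inj₁ refl) _ = ℕ.≤-refl
fork-meets-path _ (inj₂ refl) (inj₂ ()) _

incident⇒meet : ∀ a b {v} → Incident a v → Incident b v → Meet a b ⊎ a ≡ b
incident⇒meet 0 0 _ _ = inj₂ refl
incident⇒meet 0 1 _ _ = inj₁ (fork (s≤s z≤n) (s≤s (s≤s z≤n)))
incident⇒meet 1 0 _ _ = inj₁ (fork (s≤s (s≤s z≤n)) (s≤s z≤n))
incident⇒meet 1 1 _ _ = inj₂ refl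
incident⇒meet 0 (suc (suc j)) ia ib = inj₁ (fork (s≤s z≤n) (fork-meets-path j ia ib (s≤s z≤n)))
incident⇒meet 1 (suc (suc j)) ia ib = inj₁ (fork (s≤s (s≤s z≤n)) (fork-meets-path j ia ib (s≤s (s≤s z≤n))))
incident⇒meet (suc (suc i)) 0 ia ib = inj₁ (fork (fork-meets-path i ib ia (s≤s z≤n)) (s≤s z≤n))
incident⇒meet (suc (suc i)) 1 ia ib = inj₁ (fork (fork-meets-path i ib ia (s≤s (s≤s z≤n))) (s≤s (s≤s z≤n)))
incident⇒meet (suc (suc i)) (suc (suc j)) (inj₁ refl) (inj₁ eq) = inj₂ eq
incident⇒meet (suc (suc i)) (suc (suc j)) (inj₁ refl) (inj₂ eq) = inj₁ (prev (s≤s (s≤s z≤n)) eq)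
incident⇒meet (suc (suc i)) (suc (suc j)) (inj₂ refl) (inj₁ eq) = inj₁ (next (s≤s (s≤s z≤n)) (sym eq))
incident⇒meet (suc (suc i)) (suc (suc j)) (inj₂ refl) (inj₂ eq) = inj₂ (ℕ.suc-injective eq)

meeting-vertex : ∀ {a b} → Meet a b → ℕ
meeting-vertex (fork _ _) = 2
meeting-vertex (next {a} _ _) = suc a
meeting-vertex (prev {b = b} _ _) = suc b

meet⇒incident : ∀ {a b} (m : Meet a b) → Incident a (meeting-vertex m) × Incident b (meeting-vertex m)
meet⇒incident (fork a<3 b<3) = incident-2 a<3 , incident-2 b<3
meet⇒incident (next (s≤s (s≤s z≤n)) refl) = inj₂ refl , inj₁ refl
meet⇒incident (prev (s≤s (s≤s z≤n)) refl) = inj₁ refl , inj₂ refl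

meeting-vertex-≤ : ∀ {n a b} → 3 ≤ n → a < n → b < n → (m : Meet a b) → meeting-vertex m ≤ n
meeting-vertex-≤ 3≤n _ _ (fork _ _) = ℕ.≤-trans (ℕ.n≤1+n 2) 3≤n
meeting-vertex-≤ _ a<n _ (next _ _) = a<n
meeting-vertex-≤ _ _ b<n (prev _ _) = b<n

Adjacent : ∀ {n} → Fin n → Fin n → Set
Adjacent {n} a b = Σ (Fin (suc n)) λ v → Incident (toℕ a) (toℕ v) × Incident (toℕ b) (toℕ v)

meet⇒adjacent : ∀ {n} → 3 ≤ n → (a b : Fin n) → Meet (toℕ a) (toℕ b) → Adjacent a b
meet⇒adjacent {n} h a b m = fromℕ< v<1+n , map (subst (Incident _) v≡) (subst (Incident _) v≡) (meet⇒incident m)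
  where
  v<1+n : meeting-vertex m < suc n
  v<1+n = s≤s (meeting-vertex-≤ h (toℕ<n a) (toℕ<n b) m)

  v≡ : meeting-vertex m ≡ toℕ (fromℕ< v<1+n)
  v≡ = sym (toℕ-fromℕ< v<1+n)

ForkAgrees : ∀ {n} → 3 ≤ n → Ordering n → Permutation′ 3 → Set
ForkAgrees h σ τ = ∀ a b → (τ ⟨$⟩ʳ a <ᶠ τ ⟨$⟩ʳ b) ⇔ (inject≤ a h ≺[ σ ] inject≤ b h)

PathAgrees : ∀ {n} → Ordering n → (Fin n → Bool) → Set
PathAgrees σ c = ∀ a b → 2 ≤ toℕ a → toℕ b ≡ suc (toℕ a) → (a ≺[ σ ] b) ⇔ (c a ≡ true)

≺-irrefl : ∀ {n} (σ : Ordering n) {a b} → a ≡ b → ¬ (a ≺[ σ ] b)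
≺-irrefl σ refl = ℕ.<-irrefl refl

≺-connex : ∀ {n} (σ : Ordering n) {a b} → a ≢ b → ¬ (b ≺[ σ ] a) → a ≺[ σ ] b
≺-connex σ a≢b b⊀a = ≤∧≢⇒< (ℕ.≮⇒≥ b⊀a) (a≢b ∘ ⟨$⟩ʳ-injective σ)

module _ {n} (h : 3 ≤ n) (σ : Ordering n) (τ : Permutation′ 3) (c : Fin n → Bool)
         (fork-agrees : ForkAgrees h σ τ) (path-agrees : PathAgrees σ c) where

  private
    Generator : Rel (Fin n) 0ℓ
    Generator a b = linear123 h τ a b ⊎ pathChoice c a b

  generator⇒ : unionRestrict σ ⇒ Generator
  generator⇒ {a} {b} (_ , a≺b , ia , ib) with incident⇒meet (toℕ a) (toℕ b) ia ib
  ... | inj₁ (fork a<3 b<3) =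
    inj₁ (fromℕ< a<3 , fromℕ< b<3 , a≡ , b≡ ,
          Equivalence.from (fork-agrees _ _) (subst₂ _≺[ σ ]_ a≡ b≡ a≺b))
    where
    a≡ : a ≡ inject≤ (fromℕ< a<3) h
    a≡ = inject≤-fromℕ< h a a<3

    b≡ : b ≡ inject≤ (fromℕ< b<3) h
    b≡ = inject≤-fromℕ< h b b<3
  ... | inj₁ (next 2≤a b≡) = inj₂ (inj₁ (2≤a , b≡ , Equivalence.to (path-agrees a b 2≤a b≡) a≺b))
  ... | inj₁ (prev 2≤b a≡) =
    inj₂ (inj₂ (2≤b , a≡ , ¬-not (ℕ.<-asym a≺b ∘ Equivalence.from (path-agrees b a 2≤b a≡))))
  ... | inj₂ a≡b = contradiction a≺b (≺-irrefl σ (toℕ-injective a≡b))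

  generator⇐ : Generator ⇒ unionRestrict σ
  generator⇐ {a} {b} (inj₁ (a′ , b′ , refl , refl , τa<τb)) =
    let v , ia , ib = meet⇒adjacent h a b (fork (toℕ-inject≤< a′ h) (toℕ-inject≤< b′ h))
    in v , Equivalence.to (fork-agrees a′ b′) τa<τb , ia , ib
  generator⇐ {a} {b} (inj₂ (inj₁ (2≤a , b≡ , ca))) =
    let v , ia , ib = meet⇒adjacent h a b (next 2≤a b≡)
    in v , Equivalence.from (path-agrees a b 2≤a b≡) ca , ia , ib
  generator⇐ {a} {b} (inj₂ (inj₂ (2≤b , a≡ , cb))) =
    let v , ia , ib = meet⇒adjacent h a b (prev 2≤b a≡)
    in v , ≺-connex σ a≢b b⊀a , ia , ib
    where
    a≢b : a ≢ b
    a≢b refl = ℕ.<⇒≢ (ℕ.n<1+n _) a≡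

    b⊀a : ¬ (b ≺[ σ ] a)
    b⊀a b≺a with () ← trans (sym cb) (Equivalence.to (path-agrees b a 2≤b a≡) b≺a)

  p≐q : p σ ≐ q h τ c
  p≐q = TransClosure-cong λ _ _ → mk⇔ generator⇒ generator⇐

module FromOrdering {n} (h : 3 ≤ n) (σ : Ordering n) where

  _≺?_ : ∀ a b → Dec (a ≺[ σ ] b)
  a ≺? b = σ ⟨$⟩ʳ a <ᶠ? σ ⟨$⟩ʳ b

  fork-position : Fin 3 → Fin n
  fork-position a = σ ⟨$⟩ʳ inject≤ a h

  fork-position-injective : Injective _≡_ _≡_ fork-position
  fork-position-injective = inject≤-injective h h _ _ ∘ ⟨$⟩ʳ-injective σ

  open Ranking <-isStrictTotalOrder fork-position fork-position-injective
    renaming (ranking to τ; ranking-<⇔ to fork-agrees)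

  c : Fin n → Bool
  c a with suc (toℕ a) ℕ.<? n
  ... | yes a+1<n = does (a ≺? fromℕ< a+1<n)
  ... | no _ = true  -- the last edge has no successor; this value is never used

  path-agrees : PathAgrees σ c
  path-agrees a b _ b≡ with suc (toℕ a) ℕ.<? n
  ... | yes a+1<n rewrite toℕ-injective {i = fromℕ< a+1<n} {j = b} (trans (toℕ-fromℕ< a+1<n) (sym b≡)) =
    does≡true⇔ (a ≺? b)
  ... | no a+1≮n = contradiction (subst (_< n) b≡ (toℕ<n b)) a+1≮n

  p≐q-from-ordering : Σ (Permutation′ 3) λ τ → Σ (Fin n → Bool) λ c → p σ ≐ q h τ c
  p≐q-from-ordering = τ , c , p≐q h σ τ c fork-agrees path-agrees

module FromChoices {m} (h : 3 ≤ 3 + m) (τ : Permutation′ 3) (c : Fin (3 + m) → Bool) where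

  data EdgeView : Fin (3 + m) → Set where
    fork-edge : (a : Fin 3) → EdgeView (inject≤ a h)
    path-edge : (i : Fin m) → EdgeView (suc (suc (suc i)))

  edgeView : ∀ e → EdgeView e
  edgeView zero = fork-edge zero
  edgeView (suc zero) = fork-edge (suc zero)
  edgeView (suc (suc zero)) = fork-edge (suc (suc zero))
  edgeView (suc (suc (suc i))) = path-edge i

  height : Fin (3 + m) → ℤ
  height zero = + toℕ (τ ⟨$⟩ʳ zero)
  height (suc zero) = + toℕ (τ ⟨$⟩ʳ suc zero)
  height (suc (suc zero)) = + toℕ (τ ⟨$⟩ʳ suc (suc zero))
  height (suc (suc (suc i))) = signed (c (suc (suc (inject₁ i)))) (3 + toℕ i)

  height-fork : ∀ a → height (inject≤ a h) ≡ + toℕ (τ ⟨$⟩ʳ a)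
  height-fork zero = refl
  height-fork (suc zero) = refl
  height-fork (suc (suc zero)) = refl

  ∣height-fork∣≤2 : ∀ a → ∣ height (inject≤ a h) ∣ℤ ≤ 2
  ∣height-fork∣≤2 a = subst (λ z → ∣ z ∣ℤ ≤ 2) (sym (height-fork a)) (toℕ≤pred[n] (τ ⟨$⟩ʳ a))

  ∣height-path∣ : ∀ i → ∣ height (suc (suc (suc i))) ∣ℤ ≡ 3 + toℕ i
  ∣height-path∣ i = ∣signed∣ (c (suc (suc (inject₁ i)))) _

  ∣height-fork∣<∣height-path∣ : ∀ a i → ∣ height (inject≤ a h) ∣ℤ < ∣ height (suc (suc (suc i))) ∣ℤ
  ∣height-fork∣<∣height-path∣ a i =
    subst (∣ height (inject≤ a h) ∣ℤ <_) (sym (∣height-path∣ i))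
          (ℕ.≤-trans (s≤s (∣height-fork∣≤2 a)) (ℕ.m≤m+n 3 _))

  ∣height∣≤ : ∀ e → ∣ height e ∣ℤ ≤ 2 ⊔ toℕ e
  ∣height∣≤ e with edgeView e
  ... | fork-edge a = ℕ.≤-trans (∣height-fork∣≤2 a) (ℕ.m≤m⊔n 2 (toℕ (inject≤ {n = 3 + m} a h)))
  ... | path-edge i = subst (_≤ 2 ⊔ (3 + toℕ i)) (sym (∣height-path∣ i)) (ℕ.m≤n⊔m 2 _)

  height-injective : Injective _≡_ _≡_ height
  height-injective {e} {e′} eq with edgeView e | edgeView e′
  ... | fork-edge a | fork-edge b = cong (λ x → inject≤ x h) (⟨$⟩ʳ-injective τ (toℕ-injective (+-injective τa≡τb)))
    where
    τa≡τb : + toℕ (τ ⟨$⟩ʳ a) ≡ + toℕ (τ ⟨$⟩ʳ b)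
    τa≡τb = trans (sym (height-fork a)) (trans eq (height-fork b))
  ... | fork-edge a | path-edge j = contradiction (cong ∣_∣ℤ eq) (ℕ.<⇒≢ (∣height-fork∣<∣height-path∣ a j))
  ... | path-edge i | fork-edge b = contradiction (cong ∣_∣ℤ (sym eq)) (ℕ.<⇒≢ (∣height-fork∣<∣height-path∣ b i))
  ... | path-edge i | path-edge j = cong (λ j → suc (suc (suc j))) (toℕ-injective (ℕ.+-cancelˡ-≡ 3 _ _ 3+i≡3+j))
    where
    3+i≡3+j : 3 + toℕ i ≡ 3 + toℕ j
    3+i≡3+j = trans (sym (∣height-path∣ i)) (trans (cong ∣_∣ℤ eq) (∣height-path∣ j))

  ∣height∣<next : ∀ {a b : Fin (3 + m)} → 2 ≤ toℕ a → toℕ b ≡ suc (toℕ a) → ∣ height a ∣ℤ < toℕ b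
  ∣height∣<next {a} 2≤a b≡ =
    ℕ.≤-<-trans (subst (∣ height a ∣ℤ ≤_) (ℕ.m≤n⇒m⊔n≡n 2≤a) (∣height∣≤ a))
                (subst (toℕ a <_) (sym b≡) (ℕ.n<1+n _))

  height-next⇔ : ∀ {a b} → 2 ≤ toℕ a → toℕ b ≡ suc (toℕ a) → (height a <ℤ height b) ⇔ (c a ≡ true)
  height-next⇔ {a} {b} 2≤a b≡ with ∣height∣<next 2≤a b≡ | edgeView b
  ... | _ | fork-edge b′ =
    contradiction (subst (_< 3) b≡ (toℕ-inject≤< {n = 3 + m} b′ h)) (ℕ.≤⇒≯ (s≤s 2≤a))
  ... | bound | path-edge i
    with refl ← toℕ-injective {i = a} {j = suc (suc (inject₁ i))}
                  (trans (ℕ.suc-injective (sym b≡)) (cong (λ j → suc (suc j)) (sym (toℕ-inject₁ i))))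
    = <-signed⇔ (c _) bound

  open Ranking <ℤ-isStrictTotalOrder height height-injective
    renaming (ranking to σ; ranking-<⇔ to σ-<⇔)

  fork-agrees : ForkAgrees h σ τ
  fork-agrees a b =
    ⇔.trans (mk⇔ +<+ drop‿+<+)
            (subst₂ (λ x y → (x <ℤ y) ⇔ (inject≤ a h ≺[ σ ] inject≤ b h)) (height-fork a) (height-fork b)
              (⇔.sym (σ-<⇔ (inject≤ a h) (inject≤ b h))))

  path-agrees : PathAgrees σ c
  path-agrees a b 2≤a b≡ = ⇔.trans (σ-<⇔ a b) (height-next⇔ 2≤a b≡)

  p≐q-from-choices : Σ (Ordering (3 + m)) λ σ → p σ ≐ q h τ c
  p≐q-from-choices = σ , p≐q h σ τ c fork-agrees path-agrees

proposition3p17 : (n : ℕ) → (h : 3 ≤ n) →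
    ((σ : Ordering n) → Σ (Permutation′ 3) λ τ → Σ (Fin n → Bool) λ c → p σ ≐ q h τ c)
    × ((τ : Permutation′ 3) → (c : Fin n → Bool) → Σ (Ordering n) λ σ → p σ ≐ q h τ c)
proposition3p17 (suc zero) (s≤s ())
proposition3p17 (suc (suc zero)) (s≤s (s≤s ()))
proposition3p17 (suc (suc (suc m))) h = FromOrdering.p≐q-from-ordering h , FromChoices.p≐q-from-choices h
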